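{- Let $G$ be a graph with a unique maximum open packing $U(G)$, and let $x\in U(G)$ be such that there exists $y\in N(x)\cap U(G)$. If $G'$ is obtained from $G$ by appending a path $P_4$ to $x$ (adding a new path on 4 vertices and joining $x$ to one of its end vertices), then $G'$ has a unique maximum open packing.
   Context: An open packing in a graph is a set of vertices whose open neighborhoods are pairwise disjoint; a maximum open packing is one of maximum cardinality. -}

module Defs where

open import Data.Nat using (ℕ; zero; suc; _+_; _≤_)
open import Data.Bool using (Bool; true; false; _∨_; _∧_)
open import Data.Fin using (Fin; zero; suc; _↑ˡ_; _↑ʳ_; toℕ; splitAt)
open import Data.Sum using (_⊎_; inj₁; inj₂)
open import Data.Bool.Properties using (∧-comm)
open import Data.Fin.Subset using (Subset; _∈_; ∣_∣)
open import Data.Vec using (lookup)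
open import Data.Product using (_×_; Σ; _,_)
open import Relation.Binary.PropositionalEquality using (_≡_; _≢_)
open import Relation.Nullary using (¬_)

record Graph (n : ℕ) : Set where
  field
    adj   : Fin n → Fin n → Bool
    sym   : ∀ u v → adj u v ≡ adj v u
    irrefl : ∀ v → adj v v ≡ false
open Graph public

Adj : ∀ {n} → Graph n → Fin n → Fin n → Set
Adj G u v = adj G u v ≡ true

InN : ∀ {n} → Graph n → Fin n → Fin n → Set
InN G v w = Adj G v w

IsOpenPacking : ∀ {n} → Graph n → Subset n → Set
IsOpenPacking G S =
  ∀ u v → u ∈ S → v ∈ S → u ≢ v → ∀ w → ¬ (InN G u w × InN G v w)

IsMaxOpenPacking : ∀ {n} → Graph n → Subset n → Set
IsMaxOpenPacking G S =
  IsOpenPacking G S × (∀ T → IsOpenPacking G T → ∣ T ∣ ≤ ∣ S ∣)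

IsUniqueMaxOpenPacking : ∀ {n} → Graph n → Subset n → Set
IsUniqueMaxOpenPacking G U =
  IsMaxOpenPacking G U × (∀ T → IsMaxOpenPacking G T → T ≡ U)

HasUniqueMaxOpenPacking : ∀ {n} → Graph n → Set
HasUniqueMaxOpenPacking {n} G = Σ (Subset n) (IsUniqueMaxOpenPacking G)

p4adj : Fin 4 → Fin 4 → Bool
p4adj zero (suc zero) = true
p4adj (suc zero) zero = true
p4adj (suc zero) (suc (suc zero)) = true
p4adj (suc (suc zero)) (suc zero) = true
p4adj (suc (suc zero)) (suc (suc (suc zero))) = true
p4adj (suc (suc (suc zero))) (suc (suc zero)) = true
p4adj _ _ = false

p4sym : ∀ u v → p4adj u v ≡ p4adj v u
p4sym zero zero = _≡_.refl
p4sym zero (suc zero) = _≡_.refl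
p4sym zero (suc (suc zero)) = _≡_.refl
p4sym zero (suc (suc (suc zero))) = _≡_.refl
p4sym (suc zero) zero = _≡_.refl
p4sym (suc zero) (suc zero) = _≡_.refl
p4sym (suc zero) (suc (suc zero)) = _≡_.refl
p4sym (suc zero) (suc (suc (suc zero))) = _≡_.refl
p4sym (suc (suc zero)) zero = _≡_.refl
p4sym (suc (suc zero)) (suc zero) = _≡_.refl
p4sym (suc (suc zero)) (suc (suc zero)) = _≡_.refl
p4sym (suc (suc zero)) (suc (suc (suc zero))) = _≡_.refl
p4sym (suc (suc (suc zero))) zero = _≡_.refl
p4sym (suc (suc (suc zero))) (suc zero) = _≡_.refl
p4sym (suc (suc (suc zero))) (suc (suc zero)) = _≡_.refl
p4sym (suc (suc (suc zero))) (suc (suc (suc zero))) = _≡_.refl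

p4irr : ∀ v → p4adj v v ≡ false
p4irr zero = _≡_.refl
p4irr (suc zero) = _≡_.refl
p4irr (suc (suc zero)) = _≡_.refl
p4irr (suc (suc (suc zero))) = _≡_.refl

isX : ∀ {n} → Fin n → Fin n → Bool
isX zero zero = true
isX (suc a) (suc b) = isX a b
isX _ _ = false

isX-refl : ∀ {n} (x : Fin n) → isX x x ≡ true
isX-refl zero = _≡_.refl
isX-refl (suc x) = isX-refl x

-- Adjacency of G' on Fin (n + 4): old vertices are  v ↑ˡ 4,
-- new path vertices are  n ↑ʳ i  (i : Fin 4), path 0-1-2-3,
-- and x is joined to the end vertex 0 of the path.
isZero4 : Fin 4 → Bool
isZero4 zero = true
isZero4 _ = false

goAdj : ∀ {n} → Graph n → Fin n → Fin n ⊎ Fin 4 → Fin n ⊎ Fin 4 → Bool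
goAdj G x (inj₁ a) (inj₁ b) = adj G a b
goAdj G x (inj₂ i) (inj₂ j) = p4adj i j
goAdj G x (inj₁ a) (inj₂ j) = isX x a ∧ isZero4 j
goAdj G x (inj₂ i) (inj₁ b) = isZero4 i ∧ isX x b

goSym : ∀ {n} (G : Graph n) x p q → goAdj G x p q ≡ goAdj G x q p
goSym G x (inj₁ a) (inj₁ b) = sym G a b
goSym G x (inj₂ i) (inj₂ j) = p4sym i j
goSym G x (inj₁ a) (inj₂ j) = ∧-comm (isX x a) (isZero4 j)
goSym G x (inj₂ i) (inj₁ b) = ∧-comm (isZero4 i) (isX x b)

goIrr : ∀ {n} (G : Graph n) x p → goAdj G x p p ≡ false
goIrr G x (inj₁ a) = irrefl G a
goIrr G x (inj₂ i) = p4irr i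

appendP4 : ∀ {n} → Graph n → Fin n → Graph (n + 4)
appendP4 {n} G x = record
  { adj = λ u v → goAdj G x (splitAt n u) (splitAt n v)
  ; sym = λ u v → goSym G x (splitAt n u) (splitAt n v)
  ; irrefl = λ v → goIrr G x (splitAt n v)
  }

module Submission where

-- The new unique maximum open packing is U ∪ {p2, p3}.
--
-- The vertex set of G' is Fin (n + 4) = old vertices ++ path vertices, and a
-- subset of it splits as A ++ B.  The proof rests on four facts:
--   * open packings pull back along adjacency-preserving embeddings, so
--     A is an open packing of G and B one of P4; hence |A| ≤ |U|, |B| ≤ 2;
--   * U ++ {p2, p3} is an open packing of G', so it is maximum;
--   * for a maximum packing A ++ B both bounds are tight, so A = U by
--     uniqueness in G and |B| = 2;
--   * p0 and y share the neighbour x, and p1 and x share the neighbour p0,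
--     so p0, p1 ∉ B, which forces B = {p2, p3}.

open import Defs
open import Data.Nat using (ℕ; suc; _+_; _≤_; s≤s)
open import Data.Nat.Properties
  using (≤ᵇ⇒≤; +-mono-≤; +-monoʳ-≤; +-monoˡ-≤; ≤-trans; +-cancelʳ-≤; +-cancelˡ-≤; module ≤-Reasoning)
open import Data.Fin using (Fin; zero; suc; _↑ˡ_; _↑ʳ_; splitAt)
open import Data.Fin.Patterns using (0F; 1F; 2F; 3F)
open import Data.Fin.Properties using (splitAt-↑ˡ; splitAt-↑ʳ; join-splitAt; ↑ˡ-injective; ↑ʳ-injective)
open import Data.Fin.Subset using (Subset; _∈_; _∉_; ∣_∣)
open import Data.Vec using ([]; _∷_; _++_; here; there)
import Data.Vec as Vec
open import Data.Bool using (true; false; _∧_)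
open import Data.Bool.Properties using (∧-conicalˡ; ∧-conicalʳ)
open import Data.Sum using (inj₁; inj₂)
open import Data.Product using (Σ; _×_; _,_; proj₁; proj₂; uncurry)
open import Data.Empty using (⊥; ⊥-elim)
open import Relation.Binary.PropositionalEquality
  using (_≡_; refl; trans; cong; cong₂; subst; _≢_) renaming (sym to ≡-sym)
open import Relation.Nullary using (¬_)

∣++∣ : ∀ {m k} (A : Subset m) (B : Subset k) → ∣ A ++ B ∣ ≡ ∣ A ∣ + ∣ B ∣
∣++∣ []          B = refl
∣++∣ (true ∷ A)  B = cong suc (∣++∣ A B)
∣++∣ (false ∷ A) B = ∣++∣ A B

∈-++⁺ˡ : ∀ {m k} {A : Subset m} {B : Subset k} {i} → i ∈ A → i ↑ˡ k ∈ A ++ B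
∈-++⁺ˡ here      = here
∈-++⁺ˡ (there p) = there (∈-++⁺ˡ p)

∈-++⁺ʳ : ∀ {m k} {A : Subset m} {B : Subset k} {j} → j ∈ B → m ↑ʳ j ∈ A ++ B
∈-++⁺ʳ {A = []}    p = p
∈-++⁺ʳ {A = _ ∷ A} p = there (∈-++⁺ʳ {A = A} p)

∈-++⁻ˡ : ∀ {m k} {A : Subset m} {B : Subset k} {i} → i ↑ˡ k ∈ A ++ B → i ∈ A
∈-++⁻ˡ {A = _ ∷ _} {i = zero}  here      = here
∈-++⁻ˡ {A = _ ∷ _} {i = suc i} (there p) = there (∈-++⁻ˡ p)

∈-++⁻ʳ : ∀ {m k} {A : Subset m} {B : Subset k} {j} → m ↑ʳ j ∈ A ++ B → j ∈ B
∈-++⁻ʳ {A = []}    p         = p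
∈-++⁻ʳ {A = _ ∷ A} (there p) = ∈-++⁻ʳ {A = A} p

data SumView (m k : ℕ) : Fin (m + k) → Set where
  left  : (i : Fin m) → SumView m k (i ↑ˡ k)
  right : (j : Fin k) → SumView m k (m ↑ʳ j)

sumView : ∀ m k (u : Fin (m + k)) → SumView m k u
sumView m k u with splitAt m u | join-splitAt m k u
... | inj₁ i | refl = left i
... | inj₂ j | refl = right j

summands-tight : ∀ {a b c d} → a ≤ c × b ≤ d → c + d ≤ a + b → c ≤ a × d ≤ b
summands-tight {a} {b} {c} {d} (a≤c , b≤d) c+d≤a+b =
  +-cancelʳ-≤ d c a (≤-trans c+d≤a+b (+-monoʳ-≤ a b≤d)) ,
  +-cancelˡ-≤ c d b (≤-trans c+d≤a+b (+-monoˡ-≤ b a≤c))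

packing-pullback : ∀ {m k} {H : Graph m} {G : Graph k} (f : Fin m → Fin k) →
  (∀ u v → f u ≡ f v → u ≡ v) → (∀ u v → adj G (f u) (f v) ≡ adj H u v) →
  ∀ {S T} → (∀ {i} → i ∈ T → f i ∈ S) → IsOpenPacking G S → IsOpenPacking H T
packing-pullback f f-inj f-adj T⊆S pS u v u∈T v∈T u≢v w (uw , vw) =
  pS (f u) (f v) (T⊆S u∈T) (T⊆S v∈T) (λ e → u≢v (f-inj u v e)) (f w)
     (trans (f-adj u w) uw , trans (f-adj v w) vw)

P4 : Graph 4
P4 = record { adj = p4adj ; sym = p4sym ; irrefl = p4irr }

pathTail : Subset 4
pathTail = false ∷ false ∷ true ∷ true ∷ []

pathTail-not-head : ∀ {j} → j ∈ pathTail → j ≢ 0F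
pathTail-not-head (there (there here)) ()
pathTail-not-head (there (there (there here))) ()

pathTail-not-adjacent-head : ∀ {j} → j ∈ pathTail → ¬ Adj P4 j 0F
pathTail-not-adjacent-head (there (there here)) ()
pathTail-not-adjacent-head (there (there (there here))) ()

-- p2 and p3 have disjoint neighbourhoods {p1, p3} and {p2}, so {p2, p3}
-- is an open packing of P4.
p2-p3-no-common-neighbour : ∀ w → Adj P4 2F w → ¬ Adj P4 3F w
p2-p3-no-common-neighbour 1F _ ()
p2-p3-no-common-neighbour 3F _ ()

pathTail-packing : IsOpenPacking P4 pathTail
pathTail-packing _ _ (there (there here)) (there (there here)) 2≢2 _ _ = 2≢2 refl
pathTail-packing _ _ (there (there (there here))) (there (there (there here))) 3≢3 _ _ = 3≢3 refl
pathTail-packing _ _ (there (there here)) (there (there (there here))) _ w (2w , 3w) =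
  p2-p3-no-common-neighbour w 2w 3w
pathTail-packing _ _ (there (there (there here))) (there (there here)) _ w (3w , 2w) =
  p2-p3-no-common-neighbour w 2w 3w

at-most-two : ∀ b0 b1 b2 b3 → (b0 ≡ true → b2 ≡ true → ⊥) → (b1 ≡ true → b3 ≡ true → ⊥) →
  ∣ b0 ∷ b1 ∷ b2 ∷ b3 ∷ [] ∣ ≤ 2
at-most-two true  _     true  _     no02 _    = ⊥-elim (no02 refl refl)
at-most-two _     true  _     true  _    no13 = ⊥-elim (no13 refl refl)
at-most-two true  true  false false _ _ = ≤ᵇ⇒≤ _ _ _
at-most-two true  false false true  _ _ = ≤ᵇ⇒≤ _ _ _
at-most-two true  false false false _ _ = ≤ᵇ⇒≤ _ _ _
at-most-two false true  true  false _ _ = ≤ᵇ⇒≤ _ _ _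
at-most-two false true  false false _ _ = ≤ᵇ⇒≤ _ _ _
at-most-two false false true  true  _ _ = ≤ᵇ⇒≤ _ _ _
at-most-two false false true  false _ _ = ≤ᵇ⇒≤ _ _ _
at-most-two false false false true  _ _ = ≤ᵇ⇒≤ _ _ _
at-most-two false false false false _ _ = ≤ᵇ⇒≤ _ _ _

-- Every open packing of P4 has at most two vertices: p0, p2 share the
-- neighbour p1, and p1, p3 share the neighbour p2.
P4-packing-bound : ∀ B → IsOpenPacking P4 B → ∣ B ∣ ≤ 2
P4-packing-bound (b0 ∷ b1 ∷ b2 ∷ b3 ∷ []) pB = at-most-two b0 b1 b2 b3 not-p0-p2 not-p1-p3
  where
  not-p0-p2 : b0 ≡ true → b2 ≡ true → ⊥
  not-p0-p2 refl refl = pB 0F 2F here (there (there here)) (λ ()) 1F (refl , refl)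
  not-p1-p3 : b1 ≡ true → b3 ≡ true → ⊥
  not-p1-p3 refl refl = pB 1F 3F (there here) (there (there (there here))) (λ ()) 2F (refl , refl)

pathTail-unique : ∀ B → 0F ∉ B → 1F ∉ B → 2 ≤ ∣ B ∣ → B ≡ pathTail
pathTail-unique (true  ∷ _)                          0∉B _   _ = ⊥-elim (0∉B here)
pathTail-unique (false ∷ true ∷ _)                   _   1∉B _ = ⊥-elim (1∉B (there here))
pathTail-unique (false ∷ false ∷ true  ∷ true  ∷ []) _   _   _ = refl
pathTail-unique (false ∷ false ∷ true  ∷ false ∷ []) _   _   (s≤s ())
pathTail-unique (false ∷ false ∷ false ∷ true  ∷ []) _   _   (s≤s ())
pathTail-unique (false ∷ false ∷ false ∷ false ∷ []) _   _   ()

isX-sound : ∀ {n} (x i : Fin n) → isX x i ≡ true → x ≡ i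
isX-sound zero    zero    _ = refl
isX-sound (suc x) (suc i) e = cong suc (isX-sound x i e)

isZero4-sound : ∀ k → isZero4 k ≡ true → k ≡ 0F
isZero4-sound 0F _ = refl

module AppendedPath {n : ℕ} (G : Graph n) (x : Fin n) where

  G' : Graph (n + 4)
  G' = appendP4 G x

  old : Fin n → Fin (n + 4)
  old i = i ↑ˡ 4

  path : Fin 4 → Fin (n + 4)
  path j = n ↑ʳ j

  old-edges : ∀ i j → adj G' (old i) (old j) ≡ adj G i j
  old-edges i j rewrite splitAt-↑ˡ n i 4 | splitAt-↑ˡ n j 4 = refl

  path-edges : ∀ i j → adj G' (path i) (path j) ≡ adj P4 i j
  path-edges i j rewrite splitAt-↑ʳ n 4 i | splitAt-↑ʳ n 4 j = refl

  bridge-edges : ∀ i j → adj G' (old i) (path j) ≡ isX x i ∧ isZero4 j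
  bridge-edges i j rewrite splitAt-↑ˡ n i 4 | splitAt-↑ʳ n 4 j = refl

  path≢old : ∀ j i → path j ≢ old i
  path≢old j i e with trans (≡-sym (splitAt-↑ʳ n 4 j)) (trans (cong (splitAt n) e) (splitAt-↑ˡ n i 4))
  ... | ()

  bridge : ∀ i k → Adj G' (old i) (path k) → i ≡ x × k ≡ 0F
  bridge i k e = ≡-sym (isX-sound x i (∧-conicalˡ _ _ e′)) , isZero4-sound k (∧-conicalʳ _ _ e′)
    where
    e′ : isX x i ∧ isZero4 k ≡ true
    e′ = trans (≡-sym (bridge-edges i k)) e

  x-attached : Adj G' (old x) (path 0F)
  x-attached = trans (bridge-edges x 0F) (cong (_∧ true) (isX-refl x))

  restrict-old : ∀ A B → IsOpenPacking G' (A ++ B) → IsOpenPacking G A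
  restrict-old A B = packing-pullback {H = G} {G = G'} old (↑ˡ-injective 4) old-edges (∈-++⁺ˡ {B = B})

  restrict-path : ∀ A B → IsOpenPacking G' (A ++ B) → IsOpenPacking P4 B
  restrict-path A B = packing-pullback {H = P4} {G = G'} path (↑ʳ-injective n) path-edges (∈-++⁺ʳ {A = A})

  tail-neighbour : ∀ {j} w → j ∈ pathTail → Adj G' (path j) w →
    Σ (Fin 4) λ k → w ≡ path k × Adj P4 j k
  tail-neighbour {j} w j∈tail jw with sumView n 4 w
  ... | left k  = ⊥-elim (pathTail-not-head j∈tail
                    (proj₂ (bridge k j (trans (sym G' (old k) (path j)) jw))))
  ... | right k = k , refl , trans (≡-sym (path-edges j k)) jw

  -- An old vertex and a tail vertex have no common neighbour: the only
  -- path vertex adjacent to an old vertex is p0, which the tail avoids.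
  old-tail-disjoint : ∀ i j w → j ∈ pathTail → Adj G' (old i) w → ¬ Adj G' (path j) w
  old-tail-disjoint i j w j∈tail iw jw with tail-neighbour w j∈tail jw
  ... | k , refl , jk with bridge i k iw
  ...   | _ , refl = pathTail-not-adjacent-head j∈tail jk

  tail-tail-disjoint : ∀ i j w → i ∈ pathTail → j ∈ pathTail → i ≢ j →
    Adj G' (path i) w → ¬ Adj G' (path j) w
  tail-tail-disjoint i j w i∈tail j∈tail i≢j iw jw with tail-neighbour w i∈tail iw
  ... | k , refl , ik = pathTail-packing i j i∈tail j∈tail i≢j k (ik , trans (≡-sym (path-edges j k)) jw)

  -- Two distinct old vertices have no common neighbour in G' when they
  -- have none in G: a common path neighbour would force both to be x.
  old-old-disjoint : ∀ {U} → IsOpenPacking G U → ∀ i j w → i ∈ U → j ∈ U → i ≢ j →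
    Adj G' (old i) w → ¬ Adj G' (old j) w
  old-old-disjoint pU i j w i∈U j∈U i≢j iw jw with sumView n 4 w
  ... | left k  = pU i j i∈U j∈U i≢j k
                    (trans (≡-sym (old-edges i k)) iw , trans (≡-sym (old-edges j k)) jw)
  ... | right k = i≢j (trans (proj₁ (bridge i k iw)) (≡-sym (proj₁ (bridge j k jw))))

  extend-packing : ∀ {U} → IsOpenPacking G U → IsOpenPacking G' (U ++ pathTail)
  extend-packing {U} pU u v u∈ v∈ u≢v w (uw , vw) with sumView n 4 u | sumView n 4 v
  ... | left i  | left j  = old-old-disjoint pU i j w (∈-++⁻ˡ u∈) (∈-++⁻ˡ v∈) (λ e → u≢v (cong old e)) uw vw
  ... | left i  | right j = old-tail-disjoint i j w (∈-++⁻ʳ {A = U} v∈) uw vw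
  ... | right i | left j  = old-tail-disjoint j i w (∈-++⁻ʳ {A = U} u∈) vw uw
  ... | right i | right j =
    tail-tail-disjoint i j w (∈-++⁻ʳ {A = U} u∈) (∈-++⁻ʳ {A = U} v∈) (λ e → u≢v (cong path e)) uw vw

  part-bounds : ∀ {U} A B → IsMaxOpenPacking G U → IsOpenPacking G' (A ++ B) →
    ∣ A ∣ ≤ ∣ U ∣ × ∣ B ∣ ≤ 2
  part-bounds A B (_ , maxU) pAB = maxU A (restrict-old A B pAB) , P4-packing-bound B (restrict-path A B pAB)

  extension-maximum : ∀ {U} → IsMaxOpenPacking G U → IsMaxOpenPacking G' (U ++ pathTail)
  extension-maximum {U} mU = extend-packing (proj₁ mU) , bound
    where
    open ≤-Reasoning
    bound : ∀ T → IsOpenPacking G' T → ∣ T ∣ ≤ ∣ U ++ pathTail ∣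
    bound T pT with Vec.splitAt n T
    ... | A , B , refl = begin
      ∣ A ++ B ∣               ≡⟨ ∣++∣ A B ⟩
      ∣ A ∣ + ∣ B ∣            ≤⟨ uncurry +-mono-≤ (part-bounds A B mU pT) ⟩
      ∣ U ∣ + 2                ≡⟨ ∣++∣ U pathTail ⟨
      ∣ U ++ pathTail ∣        ∎

  -- p0 and y share the neighbour x, so p0 is excluded once y is present.
  head-excluded : ∀ A B {y} → IsOpenPacking G' (A ++ B) → Adj G x y → y ∈ A → 0F ∉ B
  head-excluded A B {y} pAB xy y∈A 0∈B =
    pAB (path 0F) (old y) (∈-++⁺ʳ {A = A} 0∈B) (∈-++⁺ˡ y∈A) (path≢old 0F y) (old x)
      (trans (sym G' (path 0F) (old x)) x-attached , trans (old-edges y x) (trans (sym G y x) xy))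

  -- p1 and x share the neighbour p0, so p1 is excluded once x is present.
  second-excluded : ∀ A B → IsOpenPacking G' (A ++ B) → x ∈ A → 1F ∉ B
  second-excluded A B pAB x∈A 1∈B =
    pAB (path 1F) (old x) (∈-++⁺ʳ {A = A} 1∈B) (∈-++⁺ˡ x∈A) (path≢old 1F x) (path 0F)
      (path-edges 1F 0F , x-attached)

  -- Any maximum packing A ++ B of G' meets both bounds of part-bounds, so
  -- A is a maximum packing of G, hence A = U, and B = {p2, p3}.
  extension-unique : ∀ {U y} → IsUniqueMaxOpenPacking G U → x ∈ U → Adj G x y → y ∈ U →
    ∀ T → IsMaxOpenPacking G' T → T ≡ U ++ pathTail
  extension-unique {U} (mU , uniqueU) x∈U xy y∈U T (pT , maxT) with Vec.splitAt n T
  ... | A , B , refl = cong₂ _++_ A≡U B≡tail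
    where
    U+2≤A+B : ∣ U ∣ + 2 ≤ ∣ A ∣ + ∣ B ∣
    U+2≤A+B = let open ≤-Reasoning in begin
      ∣ U ∣ + 2           ≡⟨ ∣++∣ U pathTail ⟨
      ∣ U ++ pathTail ∣   ≤⟨ maxT (U ++ pathTail) (extend-packing (proj₁ mU)) ⟩
      ∣ A ++ B ∣          ≡⟨ ∣++∣ A B ⟩
      ∣ A ∣ + ∣ B ∣       ∎
    tight : ∣ U ∣ ≤ ∣ A ∣ × 2 ≤ ∣ B ∣
    tight = summands-tight (part-bounds A B mU pT) U+2≤A+B
    A≡U : A ≡ U
    A≡U = uniqueU A (restrict-old A B pT , λ T′ pT′ → ≤-trans (proj₂ mU T′ pT′) (proj₁ tight))
    B≡tail : B ≡ pathTail
    B≡tail = pathTail-unique B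
      (head-excluded A B pT xy (U⊆A y∈U)) (second-excluded A B pT (U⊆A x∈U)) (proj₂ tight)
      where
      U⊆A : ∀ {i} → i ∈ U → i ∈ A
      U⊆A {i} = subst (i ∈_) (≡-sym A≡U)

mainTheorem14 : ∀ {n : ℕ} (G : Graph n) (U : Subset n) → IsUniqueMaxOpenPacking G U →
    (x : Fin n) → x ∈ U → Σ (Fin n) (λ y → Adj G x y × y ∈ U) →
    HasUniqueMaxOpenPacking (appendP4 G x)
mainTheorem14 G U uniqueU x x∈U (y , xy , y∈U) =
  U ++ pathTail , extension-maximum (proj₁ uniqueU) , extension-unique uniqueU x∈U xy y∈U
  where open AppendedPath G x
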